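{- Let $r\ge 3$ be an integer, let $G$ be an $n$-vertex graph and let $M\subset V(G)$ have size $m$, such that no copy of $K_r$ in $G$ intersects $M$. Let $\mu\in[0,1)$. Then there is a graph $G'$ on vertex set $V(G)$ with the following properties: (a) $G'$ has no copy of $K_r$ intersecting $M$; (b) $e(G')\ge e(G)$, with equality if and only if $G=G'$; (c) either $e(G')>e(G)+\mu^2n^2$, or $G'$ can be obtained from $G$ by deleting/inserting at most $\mu n^2$ edges (without relabelling vertices); (d) every vertex $v\in V(G)\setminus M$ has $\deg_{G'}(v)\ge n-m-\mu n-1$.
   Formalization: The parameter μ ranges over the rationals in [0,1). -}

module Defs where

open import Data.Nat using (ℕ; zero; suc; _+_)
open import Data.Bool using (Bool; true; false; _∧_; if_then_else_)
open import Data.Fin using (Fin; zero; suc; toℕ)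
import Data.Nat as ℕ
open import Data.Fin.Subset using (Subset; _∈_)
open import Data.Integer using (+_)
open import Data.Rational using (ℚ; _/_)
open import Data.Product using (∃; _×_)
open import Relation.Nullary using (¬_; does)
open import Relation.Binary.PropositionalEquality using (_≡_)

record Graph (n : ℕ) : Set where
  field
    adj    : Fin n → Fin n → Bool
    sym    : ∀ i j → adj i j ≡ adj j i
    irrefl : ∀ i → adj i i ≡ false
open Graph public

count : ∀ {n} → (Fin n → Bool) → ℕ
count {zero}  p = 0
count {suc n} p = (if p zero then 1 else 0) + count (λ i → p (suc i))

deg : ∀ {n} → Graph n → Fin n → ℕ
deg G v = count (adj G v)

sumFin : ∀ {n} → (Fin n → ℕ) → ℕ
sumFin {zero}  f = 0
sumFin {suc n} f = f zero + sumFin (λ i → f (suc i))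

countPairs : ∀ {n} → (Fin n → Fin n → Bool) → ℕ
countPairs R = sumFin (λ i → count (R i))

-- e(G): number of edges (pairs with toℕ i < toℕ j, i.e. unordered pairs)
edges : ∀ {n} → Graph n → ℕ
edges G = countPairs (λ i j → does (toℕ i ℕ.<? toℕ j) ∧ adj G i j)

xorB : Bool → Bool → Bool
xorB true  b = if b then false else true
xorB false b = b

editDist : ∀ {n} → Graph n → Graph n → ℕ
editDist G H = countPairs (λ i j → does (toℕ i ℕ.<? toℕ j) ∧ xorB (adj G i j) (adj H i j))

SameGraph : ∀ {n} → Graph n → Graph n → Set
SameGraph G H = ∀ i j → adj G i j ≡ adj H i j

IsKr : ∀ {n} (r : ℕ) → Graph n → (Fin r → Fin n) → Set
IsKr r G f = (∀ a b → f a ≡ f b → a ≡ b) × (∀ a b → ¬ (a ≡ b) → adj G (f a) (f b) ≡ true)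

NoKrMeeting : ∀ {n : ℕ} (r : ℕ) → Graph n → Subset n → Set
NoKrMeeting {n} r G M = ¬ (∃ λ (f : Fin r → Fin n) → IsKr r G f × ∃ λ a → f a ∈ M)

ℕtoℚ : ℕ → ℚ
ℕtoℚ k = (+ k) / 1

-- While some vertex v outside M has degree below n - m - μn - 1, make v adjacent to exactly
-- the vertices outside M other than v.  A copy of K_r meeting M cannot contain v (v ∉ M has no
-- neighbour in M), so it already lies in G and the hypothesis survives the step.  Each step
-- edits at most n pairs and gains more than μn edges, so the process stops after s steps with
-- at most sn edits and more than sμn new edges: if s ≥ μn the gain exceeds μ²n², otherwise
-- the edit distance is below μn².
module Submission where

open import Defs renaming (sym to adj-sym; irrefl to adj-irrefl)
open import Data.Bool using (Bool; true; false; not; _∧_; if_then_else_)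
open import Data.Fin using (Fin; zero; suc; toℕ; _≟_)
open import Data.Fin.Subset using (Subset; inside; outside; _∈_; _∉_; ∣_∣)
open import Data.Fin.Subset.Properties using (_∈?_)
open import Data.Product using (Σ; _×_; _,_)
open import Function using (_∘_)
open import Relation.Binary.PropositionalEquality
open import Relation.Nullary using (¬_; Dec; yes; no; does; contradiction)
open import Relation.Nullary.Decidable using (dec-true; dec-false)

module Combinatorial where

  open import Algebra.Properties.CommutativeSemigroup as CommSemigroupProperties using ()
  open import Data.Bool.Properties using (∧-zeroʳ)
  open import Data.Fin.Properties using (toℕ-injective)
  open import Data.Nat using (ℕ; zero; suc; _+_; _*_; _≤_; z≤n; s≤s; _<?_)
  import Data.Nat.Properties as ℕP
  open import Data.Vec using ([]; _∷_)
  open import Relation.Binary using (tri<; tri≈; tri>)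

  open CommSemigroupProperties ℕP.+-commutativeSemigroup using (interchange; x∙yz≈y∙xz)

  indicator : Bool → ℕ
  indicator b = if b then 1 else 0

  sumFin-cong : ∀ {n} {f g : Fin n → ℕ} → (∀ i → f i ≡ g i) → sumFin f ≡ sumFin g
  sumFin-cong {zero}  f≗g = refl
  sumFin-cong {suc n} f≗g = cong₂ _+_ (f≗g zero) (sumFin-cong (f≗g ∘ suc))

  sumFin-+ : ∀ {n} (f g : Fin n → ℕ) → sumFin (λ i → f i + g i) ≡ sumFin f + sumFin g
  sumFin-+ {zero}  f g = refl
  sumFin-+ {suc n} f g = trans (cong (f zero + g zero +_) (sumFin-+ (f ∘ suc) (g ∘ suc)))
                               (interchange (f zero) (g zero) _ _)

  sumFin-mono-≤ : ∀ {n} {f g : Fin n → ℕ} → (∀ i → f i ≤ g i) → sumFin f ≤ sumFin g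
  sumFin-mono-≤ {zero}  f≤g = z≤n
  sumFin-mono-≤ {suc n} f≤g = ℕP.+-mono-≤ (f≤g zero) (sumFin-mono-≤ (f≤g ∘ suc))

  sumFin-const : ∀ {n} k → sumFin {n} (λ _ → k) ≡ n * k
  sumFin-const {zero}  k = refl
  sumFin-const {suc n} k = cong (k +_) (sumFin-const {n} k)

  sumFin-zero : ∀ {n} {f : Fin n → ℕ} → (∀ i → f i ≡ 0) → sumFin f ≡ 0
  sumFin-zero {n} f≗0 = trans (sumFin-cong f≗0) (trans (sumFin-const {n} 0) (ℕP.*-zeroʳ n))

  sumFin-split : ∀ {n} (f : Fin n → ℕ) (v : Fin n)
               → sumFin f ≡ f v + sumFin (λ i → if does (i ≟ v) then 0 else f i)
  sumFin-split f zero    = refl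
  sumFin-split f (suc v) = trans (cong (f zero +_) (sumFin-split (f ∘ suc) v))
                                 (x∙yz≈y∙xz (f zero) (f (suc v)) _)

  count≡sumFin : ∀ {n} (p : Fin n → Bool) → count p ≡ sumFin (indicator ∘ p)
  count≡sumFin {zero}  p = refl
  count≡sumFin {suc n} p = cong (indicator (p zero) +_) (count≡sumFin (p ∘ suc))

  count-cong : ∀ {n} {p q : Fin n → Bool} → (∀ i → p i ≡ q i) → count p ≡ count q
  count-cong {zero}  p≗q = refl
  count-cong {suc n} p≗q = cong₂ (λ b k → indicator b + k) (p≗q zero) (count-cong (p≗q ∘ suc))

  count-none : ∀ {n} {p : Fin n → Bool} → (∀ i → p i ≡ false) → count p ≡ 0
  count-none {zero}  p≗false = refl
  count-none {suc n} p≗false rewrite p≗false zero = count-none (p≗false ∘ suc)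

  count-≤ : ∀ {n} (p : Fin n → Bool) → count p ≤ n
  count-≤ {zero}  p = z≤n
  count-≤ {suc n} p with p zero
  ... | true  = s≤s (count-≤ (p ∘ suc))
  ... | false = ℕP.m≤n⇒m≤1+n (count-≤ (p ∘ suc))

  count-split : ∀ {n} (p : Fin n → Bool) (v : Fin n)
              → count p ≡ indicator (p v) + count (λ i → not (does (i ≟ v)) ∧ p i)
  count-split p zero    = refl
  count-split p (suc v) = trans (cong (indicator (p zero) +_) (count-split (p ∘ suc) v))
                                (x∙yz≈y∙xz (indicator (p zero)) (indicator (p (suc v))) _)

  count-+ : ∀ {n} {p q r : Fin n → Bool}
          → (∀ i → indicator (p i) + indicator (q i) ≡ indicator (r i))
          → count p + count q ≡ count r
  count-+ {zero}  pq≗r = refl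
  count-+ {suc n} {p} {q} pq≗r =
    trans (interchange (indicator (p zero)) (count (p ∘ suc)) (indicator (q zero)) _)
          (cong₂ _+_ (pq≗r zero) (count-+ (pq≗r ∘ suc)))

  count-subadditive : ∀ {n} {p q r : Fin n → Bool}
                    → (∀ i → indicator (p i) ≤ indicator (q i) + indicator (r i))
                    → count p ≤ count q + count r
  count-subadditive {zero}  p≤q+r = z≤n
  count-subadditive {suc n} {p} {q} {r} p≤q+r =
    ℕP.≤-trans (ℕP.+-mono-≤ (p≤q+r zero) (count-subadditive (p≤q+r ∘ suc)))
      (ℕP.≤-reflexive (interchange (indicator (q zero)) (indicator (r zero)) (count (q ∘ suc)) _))

  countPairs-≤ : ∀ {n} (R : Fin n → Fin n → Bool) → countPairs R ≤ n * n
  countPairs-≤ {n} R =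
    ℕP.≤-trans (sumFin-mono-≤ (count-≤ ∘ R)) (ℕP.≤-reflexive (sumFin-const {n} n))

  countPairs-none : ∀ {n} {R : Fin n → Fin n → Bool} → (∀ i j → R i j ≡ false) → countPairs R ≡ 0
  countPairs-none R≗false = sumFin-zero (λ i → count-none (R≗false i))

  countPairs-subadditive : ∀ {n} {R S T : Fin n → Fin n → Bool}
                         → (∀ i j → indicator (R i j) ≤ indicator (S i j) + indicator (T i j))
                         → countPairs R ≤ countPairs S + countPairs T
  countPairs-subadditive {S = S} {T} R≤S+T =
    ℕP.≤-trans (sumFin-mono-≤ (λ i → count-subadditive (R≤S+T i)))
               (ℕP.≤-reflexive (sumFin-+ (count ∘ S) (count ∘ T)))

  -- edges G and editDist G H unfold to countPairs (upper R) for R = adj G and R = differ G H.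
  upper : ∀ {n} → (Fin n → Fin n → Bool) → Fin n → Fin n → Bool
  upper R i j = does (toℕ i <? toℕ j) ∧ R i j

  AgreeOff : ∀ {n} → Fin n → (R S : Fin n → Fin n → Bool) → Set
  AgreeOff v R S = ∀ i j → ¬ i ≡ v → ¬ j ≡ v → R i j ≡ S i j

  rowAvoiding : ∀ {n} → Fin n → (Fin n → Fin n → Bool) → Fin n → ℕ
  rowAvoiding v R i = if does (i ≟ v) then 0 else count (λ j → not (does (j ≟ v)) ∧ upper R i j)

  pairsAvoiding : ∀ {n} → Fin n → (Fin n → Fin n → Bool) → ℕ
  pairsAvoiding v R = sumFin (rowAvoiding v R)

  rowAvoiding-cong : ∀ {n} {v : Fin n} {R S} → AgreeOff v R S
                   → ∀ i → rowAvoiding v R i ≡ rowAvoiding v S i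
  rowAvoiding-cong {v = v} {R} {S} R≐S i with i ≟ v
  ... | yes _   = refl
  ... | no i≢v = count-cong entry
    where
    entry : ∀ j → not (does (j ≟ v)) ∧ upper R i j ≡ not (does (j ≟ v)) ∧ upper S i j
    entry j with j ≟ v
    ... | yes _   = refl
    ... | no j≢v = cong (does (toℕ i <? toℕ j) ∧_) (R≐S i j i≢v j≢v)

  rowAvoiding-none : ∀ {n} {v : Fin n} {R} → AgreeOff v R (λ _ _ → false)
                   → ∀ i → rowAvoiding v R i ≡ 0
  rowAvoiding-none {v = v} {R} R≐false i with i ≟ v
  ... | yes _   = refl
  ... | no i≢v = count-none entry
    where
    entry : ∀ j → not (does (j ≟ v)) ∧ upper R i j ≡ false
    entry j with j ≟ v
    ... | yes _   = refl
    ... | no j≢v = trans (cong (does (toℕ i <? toℕ j) ∧_) (R≐false i j i≢v j≢v)) (∧-zeroʳ _)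

  -- A pair {v, j} is counted once, as (j, v) if j < v and as (v, j) if v < j.
  upper-column+row : ∀ {n} (R : Fin n → Fin n → Bool) (v j : Fin n) → R j v ≡ R v j → R v v ≡ false
    → indicator (upper R j v) + indicator (not (does (j ≟ v)) ∧ upper R v j) ≡ indicator (R v j)
  upper-column+row R v j Rjv≡Rvj Rvv≡false rewrite Rjv≡Rvj with j ≟ v
  ... | yes refl rewrite Rvv≡false | ∧-zeroʳ (does (toℕ v <? toℕ v)) = refl
  ... | no j≢v with ℕP.<-cmp (toℕ j) (toℕ v)
  ...   | tri< j<v _ _ rewrite dec-true (toℕ j <? toℕ v) j<v
                             | dec-false (toℕ v <? toℕ j) (ℕP.<-asym j<v) = ℕP.+-identityʳ _
  ...   | tri≈ _ j≡v _ = contradiction (toℕ-injective j≡v) j≢v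
  ...   | tri> _ _ v<j rewrite dec-false (toℕ j <? toℕ v) (ℕP.<-asym v<j)
                             | dec-true (toℕ v <? toℕ j) v<j = refl

  countPairs-upper-splitAt : ∀ {n} (R : Fin n → Fin n → Bool) (v : Fin n)
                           → (∀ i j → R i j ≡ R j i) → R v v ≡ false
                           → countPairs (upper R) ≡ count (R v) + pairsAvoiding v R
  countPairs-upper-splitAt R v R-sym Rvv≡false = begin
    sumFin (λ i → count (upper R i))
      ≡⟨ sumFin-cong (λ i → count-split (upper R i) v) ⟩
    sumFin (λ i → indicator (upper R i v) + rest i)
      ≡⟨ sumFin-+ (λ i → indicator (upper R i v)) rest ⟩
    sumFin (λ i → indicator (upper R i v)) + sumFin rest
      ≡⟨ cong₂ _+_ (sym (count≡sumFin (λ i → upper R i v))) (sumFin-split rest v) ⟩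
    count (λ i → upper R i v) + (rest v + pairsAvoiding v R)
      ≡⟨ sym (ℕP.+-assoc (count (λ i → upper R i v)) (rest v) _) ⟩
    count (λ i → upper R i v) + rest v + pairsAvoiding v R
      ≡⟨ cong (_+ pairsAvoiding v R) (count-+ (λ j → upper-column+row R v j (R-sym j v) Rvv≡false)) ⟩
    count (R v) + pairsAvoiding v R ∎
    where
    open ≡-Reasoning
    rest : _ → ℕ
    rest i = count (λ j → not (does (j ≟ v)) ∧ upper R i j)

  pairsAvoiding-cong : ∀ {n} {v : Fin n} {R S} → AgreeOff v R S
                     → pairsAvoiding v R ≡ pairsAvoiding v S
  pairsAvoiding-cong R≐S = sumFin-cong (rowAvoiding-cong R≐S)

  edges-splitAt : ∀ {n} (G : Graph n) (v : Fin n) → edges G ≡ deg G v + pairsAvoiding v (adj G)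
  edges-splitAt G v = countPairs-upper-splitAt (adj G) v (adj-sym G) (adj-irrefl G v)

  differ : ∀ {n} → Graph n → Graph n → Fin n → Fin n → Bool
  differ G H i j = xorB (adj G i j) (adj H i j)

  xorB-self : ∀ b → xorB b b ≡ false
  xorB-self true  = refl
  xorB-self false = refl

  xorB-triangle : ∀ l a b c
                → indicator (l ∧ xorB a c) ≤ indicator (l ∧ xorB a b) + indicator (l ∧ xorB b c)
  xorB-triangle false _     _     _     = z≤n
  xorB-triangle true  true  true  _     = ℕP.≤-refl
  xorB-triangle true  false false _     = ℕP.≤-refl
  xorB-triangle true  true  false true  = z≤n
  xorB-triangle true  true  false false = s≤s z≤n
  xorB-triangle true  false true  true  = s≤s z≤n
  xorB-triangle true  false true  false = z≤n

  editDist-self : ∀ {n} (G : Graph n) → editDist G G ≡ 0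
  editDist-self G = countPairs-none (λ i j → trans (cong (_ ∧_) (xorB-self (adj G i j))) (∧-zeroʳ _))

  editDist-triangle : ∀ {n} (G H K : Graph n) → editDist G K ≤ editDist G H + editDist H K
  editDist-triangle G H K =
    countPairs-subadditive (λ i j → xorB-triangle _ (adj G i j) (adj H i j) (adj K i j))

  editDist-agreeOff : ∀ {n} (G H : Graph n) (v : Fin n) → AgreeOff v (adj G) (adj H)
                    → editDist G H ≤ n
  editDist-agreeOff {n} G H v G≐H = begin
    editDist G H                                        ≡⟨ splitAt ⟩
    count (differ G H v) + pairsAvoiding v (differ G H) ≡⟨ cong (count (differ G H v) +_) avoiding≡0 ⟩
    count (differ G H v) + 0                            ≡⟨ ℕP.+-identityʳ _ ⟩
    count (differ G H v)                                ≤⟨ count-≤ (differ G H v) ⟩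
    n                                                   ∎
    where
    open ℕP.≤-Reasoning
    splitAt : editDist G H ≡ count (differ G H v) + pairsAvoiding v (differ G H)
    splitAt = countPairs-upper-splitAt (differ G H) v
      (λ i j → cong₂ xorB (adj-sym G i j) (adj-sym H i j))
      (cong₂ xorB (adj-irrefl G v) (adj-irrefl H v))
    avoiding≡0 : pairsAvoiding v (differ G H) ≡ 0
    avoiding≡0 = sumFin-zero (rowAvoiding-none (λ i j i≢v j≢v →
      trans (cong (xorB (adj G i j)) (sym (G≐H i j i≢v j≢v))) (xorB-self (adj G i j))))

  edges-cong : ∀ {n} (G H : Graph n) → SameGraph G H → edges G ≡ edges H
  edges-cong G H G≗H = sumFin-cong (λ i → count-cong (λ j → cong (_ ∧_) (G≗H i j)))

  rewireAdj : ∀ {n} → Graph n → Subset n → Fin n → Fin n → Fin n → Bool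
  rewireAdj G M v i j with i ≟ v | j ≟ v
  ... | yes _ | yes _ = false
  ... | yes _ | no _  = not (does (j ∈? M))
  ... | no _  | yes _ = not (does (i ∈? M))
  ... | no _  | no _  = adj G i j

  rewireAdj-sym : ∀ {n} (G : Graph n) M v i j → rewireAdj G M v i j ≡ rewireAdj G M v j i
  rewireAdj-sym G M v i j with i ≟ v | j ≟ v
  ... | yes _ | yes _ = refl
  ... | yes _ | no _  = refl
  ... | no _  | yes _ = refl
  ... | no _  | no _  = adj-sym G i j

  rewireAdj-irrefl : ∀ {n} (G : Graph n) M v i → rewireAdj G M v i i ≡ false
  rewireAdj-irrefl G M v i with i ≟ v
  ... | yes _ = refl
  ... | no _  = adj-irrefl G i

  rewire : ∀ {n} → Graph n → Subset n → Fin n → Graph n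
  rewire G M v = record
    { adj = rewireAdj G M v ; sym = rewireAdj-sym G M v ; irrefl = rewireAdj-irrefl G M v }

  rewire-agreeOff : ∀ {n} (G : Graph n) M v → AgreeOff v (adj G) (adj (rewire G M v))
  rewire-agreeOff G M v i j i≢v j≢v with i ≟ v | j ≟ v
  ... | yes i≡v | _       = contradiction i≡v i≢v
  ... | no _    | yes j≡v = contradiction j≡v j≢v
  ... | no _    | no _    = refl

  rewire-neighbour∉ : ∀ {n} (G : Graph n) M v w → adj (rewire G M v) v w ≡ true → w ∉ M
  rewire-neighbour∉ G M v w vw with v ≟ v | w ≟ v
  rewire-neighbour∉ G M v w vw | no v≢v | _     = contradiction refl v≢v
  rewire-neighbour∉ G M v w () | yes _  | yes _
  rewire-neighbour∉ G M v w vw | yes _  | no _  with w ∈? M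
  rewire-neighbour∉ G M v w () | yes _  | no _  | yes _
  rewire-neighbour∉ G M v w vw | yes _  | no _  | no w∉M = w∉M

  count-outside : ∀ {n} (M : Subset n) → count (λ i → not (does (i ∈? M))) + ∣ M ∣ ≡ n
  count-outside []            = refl
  count-outside (inside ∷ M)  = trans (ℕP.+-suc _ ∣ M ∣) (cong suc (count-outside M))
  count-outside (outside ∷ M) = cong suc (count-outside M)

  rewire-deg : ∀ {n} (G : Graph n) M v → v ∉ M → suc (deg (rewire G M v) v) + ∣ M ∣ ≡ n
  rewire-deg {n} G M v v∉M = begin
    suc (deg (rewire G M v) v) + ∣ M ∣
      ≡⟨ cong (λ d → suc d + ∣ M ∣) (count-cong neighbours) ⟩
    suc (count avoiding) + ∣ M ∣
      ≡⟨ cong (λ b → indicator (not b) + count avoiding + ∣ M ∣) v∉M′ ⟨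
    indicator (outsideM v) + count avoiding + ∣ M ∣
      ≡⟨ cong (_+ ∣ M ∣) (count-split outsideM v) ⟨
    count outsideM + ∣ M ∣
      ≡⟨ count-outside M ⟩
    n ∎
    where
    open ≡-Reasoning
    outsideM : Fin _ → Bool
    outsideM j = not (does (j ∈? M))
    avoiding : Fin _ → Bool
    avoiding j = not (does (j ≟ v)) ∧ outsideM j
    v∉M′ : does (v ∈? M) ≡ false
    v∉M′ = dec-false (v ∈? M) v∉M
    neighbours : ∀ j → rewireAdj G M v v j ≡ avoiding j
    neighbours j with v ≟ v | j ≟ v
    ... | no v≢v | _     = contradiction refl v≢v
    ... | yes _  | yes _ = refl
    ... | yes _  | no _  = refl

  noKrMeeting-transfer : ∀ {n} r {G H : Graph n} {M v} → v ∉ M → AgreeOff v (adj G) (adj H)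
                       → (∀ w → adj H v w ≡ true → w ∉ M)
                       → NoKrMeeting r G M → NoKrMeeting r H M
  noKrMeeting-transfer r {G} {H} {M} {v} v∉M G≐H neighbours∉M noKr
                       (f , (f-inj , f-clique) , a , fa∈M) =
    noKr (f , (f-inj , clique-in-G) , a , fa∈M)
    where
    avoids-v : ∀ b → ¬ f b ≡ v
    avoids-v b fb≡v with b ≟ a
    ... | yes refl = v∉M (subst (_∈ M) fb≡v fa∈M)
    ... | no b≢a  =
      neighbours∉M (f a) (subst (λ x → adj H x (f a) ≡ true) fb≡v (f-clique b a b≢a)) fa∈M
    clique-in-G : ∀ b c → ¬ b ≡ c → adj G (f b) (f c) ≡ true
    clique-in-G b c b≢c = trans (G≐H (f b) (f c) (avoids-v b) (avoids-v c)) (f-clique b c b≢c)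

open Combinatorial

import Data.Integer as ℤ
import Data.Integer.Properties as ℤP
open import Data.Nat as ℕ using (ℕ; suc; _≥_; _∸_; z≤n)
import Data.Nat.Coprimality as Coprime
open import Data.Nat.Induction using (<-wellFounded)
import Data.Nat.Properties as ℕP
open import Data.Rational
  using (ℚ; mkℚ; 0ℚ; 1ℚ; _≤_; _<_; _+_; _*_; _-_; *≤*; toℚᵘ; NonNegative; nonNegative)
open import Data.Rational.Properties
open import Data.Rational.Solver using (module +-*-Solver)
import Data.Rational.Unnormalised as ℚᵘ
import Data.Rational.Unnormalised.Properties as ℚᵘP
open import Data.Sum using (_⊎_; inj₁; inj₂)
open import Function using (_⇔_; mk⇔; _on_)
open import Induction.WellFounded using (WellFounded; Acc; acc)
open import Level using (0ℓ)
open import Relation.Binary using (Rel)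
open import Relation.Binary.Construct.Closure.ReflexiveTransitive using (Star; ε; _◅_)
import Relation.Binary.Construct.On as On
open import Relation.Nullary using (¬?)
open import Relation.Nullary.Decidable using (_×-dec_)
open import Data.Fin.Properties using (any?)

ℕtoℚ-mkℚ : ∀ k → ℕtoℚ k ≡ mkℚ (ℤ.+ k) 0 (Coprime.sym (Coprime.1-coprimeTo k))
ℕtoℚ-mkℚ k = normalize-coprime (Coprime.sym (Coprime.1-coprimeTo k))

toℚᵘ-ℕtoℚ : ∀ k → toℚᵘ (ℕtoℚ k) ≡ ℚᵘ.mkℚᵘ (ℤ.+ k) 0
toℚᵘ-ℕtoℚ k = cong toℚᵘ (ℕtoℚ-mkℚ k)

ℕtoℚ-+ : ∀ a b → ℕtoℚ (a ℕ.+ b) ≡ ℕtoℚ a + ℕtoℚ b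
ℕtoℚ-+ a b = toℚᵘ-injective (begin
  toℚᵘ (ℕtoℚ (a ℕ.+ b))                ≡⟨ toℚᵘ-ℕtoℚ (a ℕ.+ b) ⟩
  ℚᵘ.mkℚᵘ (ℤ.+ (a ℕ.+ b)) 0              ≈⟨ ℚᵘ.*≡* (cong (ℤ._* ℤ.+ 1) numerators) ⟩
  ℚᵘ.mkℚᵘ (ℤ.+ a) 0 ℚᵘ.+ ℚᵘ.mkℚᵘ (ℤ.+ b) 0 ≡⟨ cong₂ ℚᵘ._+_ (toℚᵘ-ℕtoℚ a) (toℚᵘ-ℕtoℚ b) ⟨
  toℚᵘ (ℕtoℚ a) ℚᵘ.+ toℚᵘ (ℕtoℚ b)     ≈⟨ toℚᵘ-homo-+ (ℕtoℚ a) (ℕtoℚ b) ⟨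
  toℚᵘ (ℕtoℚ a + ℕtoℚ b)               ∎)
  where
  open ℚᵘP.≃-Reasoning
  numerators : ℤ.+ (a ℕ.+ b) ≡ ℤ.+ a ℤ.* ℤ.+ 1 ℤ.+ ℤ.+ b ℤ.* ℤ.+ 1
  numerators = trans (ℤP.pos-+ a b)
                     (sym (cong₂ ℤ._+_ (ℤP.*-identityʳ (ℤ.+ a)) (ℤP.*-identityʳ (ℤ.+ b))))

ℕtoℚ-* : ∀ a b → ℕtoℚ (a ℕ.* b) ≡ ℕtoℚ a * ℕtoℚ b
ℕtoℚ-* a b = toℚᵘ-injective (begin
  toℚᵘ (ℕtoℚ (a ℕ.* b))                ≡⟨ toℚᵘ-ℕtoℚ (a ℕ.* b) ⟩
  ℚᵘ.mkℚᵘ (ℤ.+ (a ℕ.* b)) 0              ≈⟨ ℚᵘ.*≡* (cong (ℤ._* ℤ.+ 1) (ℤP.pos-* a b)) ⟩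
  ℚᵘ.mkℚᵘ (ℤ.+ a) 0 ℚᵘ.* ℚᵘ.mkℚᵘ (ℤ.+ b) 0 ≡⟨ cong₂ ℚᵘ._*_ (toℚᵘ-ℕtoℚ a) (toℚᵘ-ℕtoℚ b) ⟨
  toℚᵘ (ℕtoℚ a) ℚᵘ.* toℚᵘ (ℕtoℚ b)     ≈⟨ toℚᵘ-homo-* (ℕtoℚ a) (ℕtoℚ b) ⟨
  toℚᵘ (ℕtoℚ a * ℕtoℚ b)               ∎)
  where open ℚᵘP.≃-Reasoning

ℕtoℚ-mono-≤ : ∀ {a b} → a ℕ.≤ b → ℕtoℚ a ≤ ℕtoℚ b
ℕtoℚ-mono-≤ {a} {b} a≤b = subst₂ _≤_ (sym (ℕtoℚ-mkℚ a)) (sym (ℕtoℚ-mkℚ b))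
  (*≤* (ℤP.*-monoʳ-≤-nonNeg (ℤ.+ 1) (ℤ.+≤+ a≤b)))

ℕtoℚ-cancel-< : ∀ {a b} → ℕtoℚ a < ℕtoℚ b → a ℕ.< b
ℕtoℚ-cancel-< {a} {b} a<b with a ℕ.<? b
... | yes a<ᵇb = a<ᵇb
... | no a≮b  = contradiction (<-≤-trans a<b (ℕtoℚ-mono-≤ (ℕP.≮⇒≥ a≮b))) (<-irrefl refl)

0≤ℕtoℚ : ∀ k → 0ℚ ≤ ℕtoℚ k
0≤ℕtoℚ k = ℕtoℚ-mono-≤ {0} {k} z≤n

*-nonNeg : ∀ {p q} → 0ℚ ≤ p → 0ℚ ≤ q → 0ℚ ≤ p * q
*-nonNeg {p} {q} 0≤p 0≤q = nonNegative⁻¹ (p * q)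
  {{nonNeg*nonNeg⇒nonNeg p {{nonNegative 0≤p}} q {{nonNegative 0≤q}}}}

gain⇒< : ∀ {a b x} → 0ℚ ≤ x → ℕtoℚ a + x < ℕtoℚ b → a ℕ.< b
gain⇒< {a} 0≤x gain = ℕtoℚ-cancel-< (≤-<-trans a≤a+x gain)
  where
  a≤a+x : ℕtoℚ a ≤ ℕtoℚ a + _
  a≤a+x = ≤-trans (≤-reflexive (sym (+-identityʳ (ℕtoℚ a)))) (+-monoʳ-≤ (ℕtoℚ a) 0≤x)

raise-gain : ∀ {d d′ a m n} {c} → suc d′ ℕ.+ m ≡ n → ℕtoℚ d < ℕtoℚ n - ℕtoℚ m - c - 1ℚ
           → ℕtoℚ (d ℕ.+ a) + c < ℕtoℚ (d′ ℕ.+ a)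
raise-gain {d} {d′} {a} {m} {c = c} refl low = begin-strict
  ℕtoℚ (d ℕ.+ a) + c                                     ≡⟨ cong (_+ c) (ℕtoℚ-+ d a) ⟩
  ℕtoℚ d + ℕtoℚ a + c                                    <⟨ +-monoˡ-< c (+-monoˡ-< (ℕtoℚ a) low) ⟩
  ℕtoℚ (suc d′ ℕ.+ m) - ℕtoℚ m - c - 1ℚ + ℕtoℚ a + c
    ≡⟨ cong (λ x → x - ℕtoℚ m - c - 1ℚ + ℕtoℚ a + c) n≡ ⟩
  1ℚ + ℕtoℚ d′ + ℕtoℚ m - ℕtoℚ m - c - 1ℚ + ℕtoℚ a + c
    ≡⟨ cancel (ℕtoℚ d′) (ℕtoℚ m) c (ℕtoℚ a) ⟩
  ℕtoℚ d′ + ℕtoℚ a                                       ≡⟨ ℕtoℚ-+ d′ a ⟨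
  ℕtoℚ (d′ ℕ.+ a)                                        ∎
  where
  open ≤-Reasoning
  open +-*-Solver
  n≡ : ℕtoℚ (suc d′ ℕ.+ m) ≡ 1ℚ + ℕtoℚ d′ + ℕtoℚ m
  n≡ = trans (ℕtoℚ-+ (suc d′) m) (cong (_+ ℕtoℚ m) (ℕtoℚ-+ 1 d′))
  cancel : ∀ x y z w → 1ℚ + x + y - y - z - 1ℚ + w + z ≡ x + w
  cancel = solve 4 (λ x y z w → con 1ℚ :+ x :+ y :- y :- z :- con 1ℚ :+ w :+ z := x :+ w)
                   refl

accumulate-gain : ∀ {x y z c : ℚ} {s} → x + c < y → y + ℕtoℚ s * c < z
                → x + ℕtoℚ (suc s) * c < z
accumulate-gain {x} {y} {z} {c} {s} first rest = begin-strict
  x + ℕtoℚ (suc s) * c    ≡⟨ cong (λ k → x + k * c) (ℕtoℚ-+ 1 s) ⟩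
  x + (1ℚ + ℕtoℚ s) * c   ≡⟨ distrib x (ℕtoℚ s) c ⟩
  x + c + ℕtoℚ s * c      <⟨ +-monoˡ-< (ℕtoℚ s * c) first ⟩
  y + ℕtoℚ s * c          <⟨ rest ⟩
  z                       ∎
  where
  open ≤-Reasoning
  open +-*-Solver
  distrib : ∀ x s c → x + (1ℚ + s) * c ≡ x + c + s * c
  distrib = solve 3 (λ x s c → x :+ (con 1ℚ :+ s) :* c := x :+ c :+ s :* c) refl

many-steps-gain : ∀ {x y μ n s} → 0ℚ ≤ μ → μ * ℕtoℚ n ≤ ℕtoℚ s
                → x + ℕtoℚ s * (μ * ℕtoℚ n) < y → x + μ * μ * ℕtoℚ n * ℕtoℚ n < y
many-steps-gain {x} {y} {μ} {n} {s} 0≤μ μn≤s gain = begin-strict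
  x + μ * μ * ℕtoℚ n * ℕtoℚ n        ≡⟨ cong (x +_) (square μ (ℕtoℚ n)) ⟩
  x + (μ * ℕtoℚ n) * (μ * ℕtoℚ n)    ≤⟨ +-monoʳ-≤ x (*-monoʳ-≤-nonNeg (μ * ℕtoℚ n) {{μn≥0}} μn≤s) ⟩
  x + ℕtoℚ s * (μ * ℕtoℚ n)          <⟨ gain ⟩
  y                                  ∎
  where
  open ≤-Reasoning
  open +-*-Solver
  square : ∀ μ n → μ * μ * n * n ≡ (μ * n) * (μ * n)
  square = solve 2 (λ μ n → μ :* μ :* n :* n := (μ :* n) :* (μ :* n)) refl
  μn≥0 : NonNegative (μ * ℕtoℚ n)
  μn≥0 = nonNegative (*-nonNeg 0≤μ (0≤ℕtoℚ n))

few-steps-edits : ∀ {d s n μ} → ℕtoℚ s < μ * ℕtoℚ n → d ℕ.≤ s ℕ.* n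
                → ℕtoℚ d ≤ μ * ℕtoℚ n * ℕtoℚ n
few-steps-edits {d} {s} {n} {μ} s<μn d≤sn = begin
  ℕtoℚ d               ≤⟨ ℕtoℚ-mono-≤ d≤sn ⟩
  ℕtoℚ (s ℕ.* n)       ≡⟨ ℕtoℚ-* s n ⟩
  ℕtoℚ s * ℕtoℚ n      ≤⟨ *-monoʳ-≤-nonNeg (ℕtoℚ n) {{nonNegative (0≤ℕtoℚ n)}} (<⇒≤ s<μn) ⟩
  μ * ℕtoℚ n * ℕtoℚ n  ∎
  where open ≤-Reasoning

large-gain-or-few-edits : ∀ {x y μ n s d} → 0ℚ ≤ μ
                        → x + ℕtoℚ s * (μ * ℕtoℚ n) < y → d ℕ.≤ s ℕ.* n
                        → (x + μ * μ * ℕtoℚ n * ℕtoℚ n < y) ⊎ (ℕtoℚ d ≤ μ * ℕtoℚ n * ℕtoℚ n)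
large-gain-or-few-edits {x} {y} {μ} {n} {s} {d} 0≤μ gain d≤sn
  with μ * ℕtoℚ n ≤? ℕtoℚ s
... | yes μn≤s = inj₁ (many-steps-gain {x} {y} {μ} {n} {s} 0≤μ μn≤s gain)
... | no μn≰s  = inj₂ (few-steps-edits {d} {s} {n} {μ} (≰⇒> μn≰s) d≤sn)

record Improves {n} (c : ℚ) (G H : Graph n) : Set where
  constructor improves
  field
    few-edits : editDist G H ℕ.≤ n
    gain      : ℕtoℚ (edges G) + c < ℕtoℚ (edges H)

steps : ∀ {A : Set} {R : Rel A 0ℓ} {x y} → Star R x y → ℕ
steps ε       = 0
steps (_ ◅ p) = suc (steps p)

editDist-chain : ∀ {n c} {G H : Graph n} (p : Star (Improves c) G H)
               → editDist G H ℕ.≤ steps p ℕ.* n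
editDist-chain {G = G} ε = ℕP.≤-reflexive (editDist-self G)
editDist-chain {G = G} {H} (_◅_ {j = G₁} (improves few-edits _) p) =
  ℕP.≤-trans (editDist-triangle G G₁ H) (ℕP.+-mono-≤ few-edits (editDist-chain p))

edges-chain : ∀ {n c} {G G₁ H : Graph n} → Improves c G G₁ → (p : Star (Improves c) G₁ H)
            → ℕtoℚ (edges G) + ℕtoℚ (suc (steps p)) * c < ℕtoℚ (edges H)
edges-chain {c = c} {G} {H = H} (improves _ gain) ε =
  subst (λ x → ℕtoℚ (edges G) + x < ℕtoℚ (edges H)) (sym (*-identityˡ c)) gain
edges-chain {G = G} {G₁} {H} (improves _ gain) (step ◅ p) =
  accumulate-gain {ℕtoℚ (edges G)} {ℕtoℚ (edges G₁)} {ℕtoℚ (edges H)} {s = suc (steps p)} gain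
    (edges-chain step p)

edges-grow : ∀ {n c} {G H : Graph n} → 0ℚ ≤ c → Star (Improves c) G H
           → edges H ≥ edges G × ((edges H ≡ edges G) ⇔ SameGraph G H)
edges-grow 0≤c ε = ℕP.≤-refl , mk⇔ (λ _ _ _ → refl) (λ _ → refl)
edges-grow {c = c} {G} {H} 0≤c (step ◅ p) =
  ℕP.<⇒≤ G<H
  , mk⇔ (λ H≡G → contradiction (sym H≡G) G≢H) (λ G≗H → contradiction (edges-cong G H G≗H) G≢H)
  where
  G<H : edges G ℕ.< edges H
  G<H = gain⇒< {edges G} {edges H} (*-nonNeg (0≤ℕtoℚ (suc (steps p))) 0≤c) (edges-chain step p)
  G≢H : ¬ edges G ≡ edges H
  G≢H = ℕP.<⇒≢ G<H

gain-or-few-edits : ∀ {n μ} {G H : Graph n} → 0ℚ ≤ μ → Star (Improves (μ * ℕtoℚ n)) G H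
                  → (ℕtoℚ (edges G) + μ * μ * ℕtoℚ n * ℕtoℚ n < ℕtoℚ (edges H))
                    ⊎ (ℕtoℚ (editDist G H) ≤ μ * ℕtoℚ n * ℕtoℚ n)
gain-or-few-edits {n} {μ} {G} 0≤μ ε =
  inj₂ (subst (λ d → ℕtoℚ d ≤ μ * ℕtoℚ n * ℕtoℚ n) (sym (editDist-self G))
              (*-nonNeg {μ * ℕtoℚ n} {ℕtoℚ n} (*-nonNeg 0≤μ (0≤ℕtoℚ n)) (0≤ℕtoℚ n)))
gain-or-few-edits {n} {μ} {G} {H} 0≤μ p@(step ◅ p′) =
  large-gain-or-few-edits {ℕtoℚ (edges G)} {ℕtoℚ (edges H)} {μ} {n} {steps p} {editDist G H} 0≤μ
    (edges-chain step p′) (editDist-chain p)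

module Saturation {n : ℕ} (r : ℕ) (M : Subset n) (μ : ℚ) (0≤μ : 0ℚ ≤ μ) where

  targetDegree : ℚ
  targetDegree = ℕtoℚ n - ℕtoℚ ∣ M ∣ - μ * ℕtoℚ n - 1ℚ

  MinDegreeOutside : Graph n → Set
  MinDegreeOutside G = ∀ v → v ∉ M → targetDegree ≤ ℕtoℚ (deg G v)

  LowDegree : Graph n → Fin n → Set
  LowDegree G v = v ∉ M × ℕtoℚ (deg G v) < targetDegree

  lowDegree? : ∀ G v → Dec (LowDegree G v)
  lowDegree? G v = ¬? (v ∈? M) ×-dec (ℕtoℚ (deg G v) <? targetDegree)

  0≤μn : 0ℚ ≤ μ * ℕtoℚ n
  0≤μn = *-nonNeg 0≤μ (0≤ℕtoℚ n)

  rewire-improves : ∀ {G v} → LowDegree G v → Improves (μ * ℕtoℚ n) G (rewire G M v)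
  rewire-improves {G} {v} (v∉M , low) = improves (editDist-agreeOff G H v G≐H) (begin-strict
    ℕtoℚ (edges G) + μ * ℕtoℚ n
      ≡⟨ cong (λ e → ℕtoℚ e + μ * ℕtoℚ n) (edges-splitAt G v) ⟩
    ℕtoℚ (deg G v ℕ.+ pairsAvoiding v (adj G)) + μ * ℕtoℚ n
      <⟨ raise-gain {deg G v} {deg H v} {pairsAvoiding v (adj G)} {c = μ * ℕtoℚ n}
                    (rewire-deg G M v v∉M) low ⟩
    ℕtoℚ (deg H v ℕ.+ pairsAvoiding v (adj G))
      ≡⟨ cong (λ a → ℕtoℚ (deg H v ℕ.+ a)) (pairsAvoiding-cong {v = v} {adj G} {adj H} G≐H) ⟩
    ℕtoℚ (deg H v ℕ.+ pairsAvoiding v (adj H))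
      ≡⟨ cong ℕtoℚ (edges-splitAt H v) ⟨
    ℕtoℚ (edges H) ∎)
    where
    open ≤-Reasoning
    H : Graph n
    H = rewire G M v
    G≐H : AgreeOff v (adj G) (adj H)
    G≐H = rewire-agreeOff G M v

  _⊏_ : Rel (Graph n) 0ℓ
  _⊏_ = ℕ._<_ on (λ G → n ℕ.* n ∸ edges G)

  ⊏-wellFounded : WellFounded _⊏_
  ⊏-wellFounded = On.wellFounded (λ G → n ℕ.* n ∸ edges G) <-wellFounded

  improves⇒⊏ : ∀ {G H} → Improves (μ * ℕtoℚ n) G H → H ⊏ G
  improves⇒⊏ {G} {H} (improves _ gain) =
    ℕP.∸-monoʳ-< (gain⇒< {edges G} {edges H} 0≤μn gain) (countPairs-≤ (upper (adj H)))

  saturate : ∀ G → Acc _⊏_ G → NoKrMeeting r G M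
           → Σ (Graph n) λ G′ →
               Star (Improves (μ * ℕtoℚ n)) G G′ × NoKrMeeting r G′ M × MinDegreeOutside G′
  saturate G (acc smaller) noKr with any? (lowDegree? G)
  ... | no noneLow = G , ε , noKr , λ v v∉M → ≮⇒≥ (λ low → noneLow (v , v∉M , low))
  ... | yes (v , low@(v∉M , _))
    with saturate (rewire G M v) (smaller (improves⇒⊏ (rewire-improves low)))
           (noKrMeeting-transfer r {G} {rewire G M v} v∉M (rewire-agreeOff G M v)
                                 (rewire-neighbour∉ G M v) noKr)
  ...   | G′ , chain , noKr′ , minDegree′ = G′ , rewire-improves low ◅ chain , noKr′ , minDegree′

lemma2p2 : (r n m : ℕ) → r ≥ 3 → (G : Graph n) → (M : Subset n) → ∣ M ∣ ≡ m
    → NoKrMeeting r G M → (μ : ℚ) → 0ℚ ≤ μ → μ < 1ℚ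
    → Σ (Graph n) λ G′ →
        NoKrMeeting r G′ M
      × (edges G′ ≥ edges G × ((edges G′ ≡ edges G) ⇔ SameGraph G G′))
      × ((ℕtoℚ (edges G) + μ * μ * ℕtoℚ n * ℕtoℚ n < ℕtoℚ (edges G′))
          ⊎ (ℕtoℚ (editDist G G′) ≤ μ * ℕtoℚ n * ℕtoℚ n))
      × (∀ (v : Fin n) → v ∉ M
          → ℕtoℚ n - ℕtoℚ m - μ * ℕtoℚ n - 1ℚ ≤ ℕtoℚ (deg G′ v))
lemma2p2 r n m _ G M refl noKr μ 0≤μ _ =
  let G′ , chain , noKr′ , minDegree′ = saturate G (⊏-wellFounded G) noKr
  in  G′ , noKr′ , edges-grow 0≤μn chain , gain-or-few-edits 0≤μ chain , minDegree′
  where open Saturation r M μ 0≤μ
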